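{- (1) Let $DT$ be a firm decision type (with $ST(DT)$ a proper prefix of $\pi_T$) and let $S^* \in {\bf Ext}(DT)$. Let $DT^*=Succ^*_{DT}(S^*)$ and $\varphi_{DT,S^*}=(\varphi_{DT}|_{S^*})\setminus \varphi_{DT^*}$. Then $\varphi_{DT,S^*}$ has primal treewidth at most $k$. (2) Let $DT$ be a decision type such that $ST(DT)=\pi_T$. Then $\varphi_{DT}$ has primal treewidth at most $k$.
   Context: $\varphi$ is an unsatisfiable CNF containing clauses $C_1,\dots,C_p$ ("long clauses") such that $\varphi\setminus\{C_1,\dots,C_p\}$ has primal treewidth at most $k$; $(T,{\bf B})$ is a primal tree decomposition of width at most $k$ of $\varphi\setminus\{C_1,\dots,C_p\}$, with $T$ rooted, binary, $|V(T)|=O(n)$. $\pi_T$ is the postorder traversal of $V(T)$; $u<v$ means $u$ precedes $v$ in $\pi_T$. For a prefix $ST$ of $\pi_T$, $Trees(ST)$ is the set of (at most $\log|V(T)|$) disjoint rooted subtrees of $T$ whose union is $T[ST]$; each forms a consecutive interval of $\pi_T$. $Var(\cdot)$ of a node set/tree is the union of its bags. $MinBag(x)$ is the earliest node (in $\pi_T$) whose bag contains $x$; $x<_T y$ iff $MinBag(x)<MinBag(y)$. For a set $S$ of literals and clause $C$: $S$ satisfies $C$ if $C\cap S\neq\emptyset$; otherwise $C|_S=C\setminus\{\neg\ell:\ell\in S\}$; $\psi|_S$ is the set of $C|_S$ over clauses $C$ of $\psi$ not satisfied by $S$. A subCNF $\psi'\subseteq\psi$ is modular if it shares no variables with $\psi\setminus\psi'$.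 For $ST$ a prefix of $\pi_T$ and $S$ a set of literals with $Var(S)\subseteq Var(ST)$: $x$ is a determining variable w.r.t. $S$ if for some long clause $C$ with $x\in Var(C)$, no $y\in Var(C)$ with $y<_T x$ occurs in $S$ in a way satisfying $C$. If $S$ satisfies long clause $C$, its satisfying tree is the tree of $Trees(ST)$ containing $MinBag$ of the $<_T$-smallest variable of $S\cap C$; $STrees$ denotes the set of satisfying trees and $Roots$ their roots. $(ST,S)$ is an interesting pair if (i) all determining variables (in $Var(ST)$) occur in $S$; (ii) a non-determining variable occurs in $S$ only if it lies in a satisfying tree; (iii) all variables in the bags of $Roots$ occur in $S$. Its decision type $DType(ST,S)=(ST,Trees',{\bf C'},F,SL)$ where $Trees'$ = satisfying trees, ${\bf C'}$ = long clauses satisfied by $S$, $F(C)$ = satisfying tree of $C$, $SL$ = the part of $S$ on the root-bag variables of $Trees'$. ${\bf S}(DT)$ = all $S$ with $DType(ST(DT),S)=DT$. $Inv(DT)$ = the long clauses not in ${\bf C'}$ together with the non-long clauses $C$ with $Var(C)\not\subseteq Var(Trees')$. $\varphi_{DT}$ = the set of $C|_S$ for $C\in Inv(DT)$ not satisfied by $S$, for any $S\in{\bf S}(DT)$ (this is independent of the choice of $S$, and $\varphi_{DT}$ is a modular subCNF of $\varphi|_S$). If $ST=ST(DT)$ is a proper prefix with immediate successor $t$, $U(DT)\subseteq B(t)$ is the set of variables of $B(t)$ unassigned by every $S\in{\bf S}(DT)$ (the same set for all such $S$). ${\bf Ext}(DT)$ is defined by: if $U(DT)=\emptyset$, it is $\{\emptyset\}$;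 else if $T_t$ contains a satisfying tree of $DT$ as a subtree, it is all sets of literals over $U(DT)$; else let $U_1$ = variables of $U(DT)$ occurring in long clauses not in ${\bf C'}$; if $U_1=\emptyset$ it is $\{\emptyset\}$; otherwise it consists of $S_1\cup S_2$ where $S_1$ is any full assignment to $U_1$ and $S_2$ is any full assignment to $U(DT)\setminus U_1$ if $S_1$ satisfies some long clause not in ${\bf C'}$, and $S_2=\emptyset$ otherwise. For $S_0\in{\bf S}(DT)$ and $S\in{\bf Ext}(DT)$, $(ST+t,S_0\cup S)$ is an interesting pair whose decision type $Succ_{DT}(S)$ depends only on $DT$ and $S$. $DT$ is firm if ${\bf Ext}(DT)\neq\{\emptyset\}$ and transient if ${\bf Ext}(DT)=\{\emptyset\}$. $Succ^*_{DT}(S)$ equals $Succ_{DT}(S)$ if that is firm; otherwise one iterates $D\mapsto Succ_D(\emptyset)$ through transient types until reaching a firm type or one with $ST=\pi_T$, and takes that type. -}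

module Defs where

open import Data.Nat as ℕ using (ℕ; zero; suc; _≤_; _<_; _∸_)
open import Data.Bool as 𝔹 using (Bool; true; false; not)
open import Data.List using (List; []; _∷_; _++_; [_]; length; filter; deduplicate)
open import Data.List.Relation.Unary.All using (All)
open import Data.List.Membership.Propositional using (_∈_; _∉_)
import Data.List.Membership.DecPropositional as DecMem
open import Data.Maybe using (Maybe; just; nothing; maybe)
open import Data.Product using (Σ; ∃; ∃-syntax; _×_; _,_; proj₁; proj₂)
open import Data.Product.Properties using (≡-dec)
open import Data.Sum using (_⊎_)
open import Relation.Nullary using (¬_; ¬?)
open import Relation.Binary.PropositionalEquality using (_≡_; _≢_)
open import Relation.Binary.Definitions using (DecidableEquality)

Var : Set
Var = ℕ

-- (true , x) is the literal x, (false , x) is the literal ¬x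
Lit : Set
Lit = Bool × Var

var : Lit → Var
var = proj₂

neg : Lit → Lit
neg (b , x) = (not b , x)

_≟L_ : DecidableEquality Lit
_≟L_ = ≡-dec 𝔹._≟_ ℕ._≟_

-- clauses and sets of literals are lists read as sets (membership)
Clause : Set
Clause = List Lit

CNF : Set
CNF = List Clause

ClauseSet : Set₁
ClauseSet = Clause → Set

Occurs : Var → List Lit → Set
Occurs x S = ∃[ b ] ((b , x) ∈ S)

Sat : List Lit → Clause → Set
Sat S C = ∃[ l ] (l ∈ C × l ∈ S)

Consistent : List Lit → Set
Consistent S = ∀ x → ¬ (((true , x) ∈ S) × ((false , x) ∈ S))

SameSet : List Lit → List Lit → Set
SameSet D E = ∀ l → ((l ∈ D → l ∈ E) × (l ∈ E → l ∈ D))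

EmptySet : List Lit → Set
EmptySet E = ∀ l → l ∉ E

restrict : List Lit → Clause → Clause
restrict S C = filter (λ l → ¬? (neg l ∈? S)) C
  where open DecMem _≟L_ using (_∈?_)

RestrictSet : ClauseSet → List Lit → ClauseSet
RestrictSet ψ S D = ∃[ C ] (ψ C × ¬ Sat S C × D ≡ restrict S C)

Minus : ClauseSet → ClauseSet → ClauseSet
Minus ψ χ D = ψ D × ¬ (∃[ D' ] (χ D' × SameSet D D'))

Unsat : CNF → Set
Unsat φ = ¬ (Σ (Var → Bool) λ a → ∀ C → C ∈ φ → ∃[ l ] (l ∈ C × a (var l) ≡ proj₁ l))

-- Rooted trees with bags; nodes are identified with their postorder index

data Tree : Set where
  node : List Var → List Tree → Tree

data Binary : Tree → Set where
  bin : ∀ {b ts} → length ts ≤ 2 → All Binary ts → Binary (node b ts)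

mutual
  post : Tree → List (List Var × ℕ)
  post (node b ts) = postF ts ++ [ (b , suc (length (postF ts))) ]

  postF : List Tree → List (List Var × ℕ)
  postF [] = []
  postF (t ∷ ts) = post t ++ postF ts

nth : {A : Set} → List A → ℕ → Maybe A
nth [] _ = nothing
nth (a ∷ as) zero = just a
nth (a ∷ as) (suc n) = nth as n

nodeCount : Tree → ℕ
nodeCount T = length (post T)

bagOf : Tree → ℕ → List Var
bagOf T u = maybe proj₁ [] (nth (post T) u)

sizeOf : Tree → ℕ → ℕ
sizeOf T u = maybe proj₂ 0 (nth (post T) u)

-- first postorder index of the subtree rooted at v
lo : Tree → ℕ → ℕ
lo T v = suc v ∸ sizeOf T v

-- v is an ancestor of u or v = u  (u is a node of T_v)
Anc : Tree → ℕ → ℕ → Set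
Anc T v u = v < nodeCount T × u < nodeCount T × lo T v ≤ u × u ≤ v

OnPath : Tree → ℕ → ℕ → ℕ → Set
OnPath T u v w = (Anc T w u ⊎ Anc T w v) × (∀ a → Anc T a u → Anc T a v → Anc T a w)

TreeDecOf : Tree → ClauseSet → Set
TreeDecOf T ψ =
  (∀ C → ψ C → ∀ x y → Occurs x C → Occurs y C →
     ∃[ u ] (u < nodeCount T × x ∈ bagOf T u × y ∈ bagOf T u))
  × (∀ x u v w → x ∈ bagOf T u → x ∈ bagOf T v → OnPath T u v w → x ∈ bagOf T w)

WidthAtMost : Tree → ℕ → Set
WidthAtMost T k = ∀ u → u < nodeCount T → length (deduplicate ℕ._≟_ (bagOf T u)) ≤ suc k

PrimalTWAtMost : ClauseSet → ℕ → Set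
PrimalTWAtMost ψ k = ∃[ T ] (TreeDecOf T ψ × WidthAtMost T k)

-- The setting: long clauses, the other clauses, decomposition T.
-- A prefix ST of π_T is given by its length j (nodes 0 … j-1);
-- the immediate successor of a proper prefix of length j is node j.

module Setup (Long Short : CNF) (T : Tree) where

  N : ℕ
  N = nodeCount T

  bag : ℕ → List Var
  bag = bagOf T

  IsMinBag : Var → ℕ → Set
  IsMinBag x m = m < N × x ∈ bag m × (∀ u → u < m → x ∉ bag u)

  _<T_ : Var → Var → Set
  x <T y = ∃[ mx ] ∃[ my ] (IsMinBag x mx × IsMinBag y my × mx < my)

  VarPre : ℕ → Var → Set
  VarPre j x = ∃[ u ] (u < j × x ∈ bag u)

  SatBy : List Lit → Clause → Var → Set
  SatBy S C y = ∃[ b ] ((b , y) ∈ S × (b , y) ∈ C)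

  Determining : List Lit → Var → Set
  Determining S x = ∃[ C ] (C ∈ Long × Occurs x C ×
                      (∀ y → Occurs y C → y <T x → ¬ SatBy S C y))

  TreeRoot : ℕ → ℕ → Set
  TreeRoot j r = r < j × (∀ w → w < j → w ≢ r → ¬ Anc T w r)

  SatRoot : ℕ → List Lit → Clause → ℕ → Set
  SatRoot j S C r = C ∈ Long × Sat S C ×
    ∃[ y ] ∃[ m ] (SatBy S C y × IsMinBag y m ×
       (∀ y' m' → SatBy S C y' → IsMinBag y' m' → m ≤ m') ×
       TreeRoot j r × Anc T r m)

  IsRoot : ℕ → List Lit → ℕ → Set
  IsRoot j S r = ∃[ C ] SatRoot j S C r

  InSatTree : ℕ → List Lit → Var → Set
  InSatTree j S x = ∃[ r ] ∃[ u ] (IsRoot j S r × Anc T r u × x ∈ bag u)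

  Interesting : ℕ → List Lit → Set
  Interesting j S =
    j ≤ N × Consistent S ×
    (∀ x → Occurs x S → VarPre j x) ×
    (∀ x → VarPre j x → Determining S x → Occurs x S) ×
    (∀ x → Occurs x S → ¬ Determining S x → InSatTree j S x) ×
    (∀ r x → IsRoot j S r → x ∈ bag r → Occurs x S)

  OpenLong : List Lit → Clause → Set
  OpenLong S C = C ∈ Long × ¬ Sat S C

  Inv : ℕ → List Lit → ClauseSet
  Inv j S C = OpenLong S C ⊎ (C ∈ Short × ¬ (∀ x → Occurs x C → InSatTree j S x))

  -- φ_DT, computed from a representative S of DT = DType(ST,S)
  PhiDT : ℕ → List Lit → ClauseSet
  PhiDT j S D = ∃[ C ] (Inv j S C × ¬ Sat S C × D ≡ restrict S C)

  U : ℕ → List Lit → Var → Set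
  U j S x = x ∈ bag j × ¬ Occurs x S

  U₁ : ℕ → List Lit → Var → Set
  U₁ j S x = U j S x × ∃[ C ] (OpenLong S C × Occurs x C)

  ContainsSatTree : ℕ → List Lit → Set
  ContainsSatTree j S = ∃[ r ] (IsRoot j S r × Anc T j r)

  Full : (Var → Set) → List Lit → Set
  Full V E = Consistent E × (∀ l → l ∈ E → V (var l)) × (∀ x → V x → Occurs x E)

  NoVar : (Var → Set) → Set
  NoVar V = ∀ x → ¬ V x

  Ext : ℕ → List Lit → List Lit → Set
  Ext j S E =
    (NoVar (U j S) × EmptySet E)
    ⊎ (¬ NoVar (U j S) × ContainsSatTree j S × Full (U j S) E)
    ⊎ (¬ NoVar (U j S) × ¬ ContainsSatTree j S × NoVar (U₁ j S) × EmptySet E)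
    ⊎ (¬ NoVar (U j S) × ¬ ContainsSatTree j S × ¬ NoVar (U₁ j S) ×
        ∃[ S₁ ] ∃[ S₂ ] (SameSet E (S₁ ++ S₂) × Full (U₁ j S) S₁ ×
          ((∃[ C ] (OpenLong S C × Sat S₁ C) ×
               Full (λ x → U j S x × ¬ U₁ j S x) S₂)
           ⊎ (¬ (∃[ C ] (OpenLong S C × Sat S₁ C)) × EmptySet S₂))))

  Transient : ℕ → List Lit → Set
  Transient j S = ∀ E → ((Ext j S E → EmptySet E) × (EmptySet E → Ext j S E))

  Firm : ℕ → List Lit → Set
  Firm j S = ¬ Transient j S

  -- j' = ST(Succ*_DT(S*)); its representative is S₀ ∪ S*
  SuccStar : ℕ → List Lit → List Lit → ℕ → Set
  SuccStar j S₀ S* j' =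
    j < j' × j' ≤ N × (j' ≡ N ⊎ Firm j' (S₀ ++ S*)) ×
    (∀ i → j < i → i < j' → Transient i (S₀ ++ S*))

-- Both bounds are witnessed by the decomposition T of the short clauses itself:
-- every clause of the CNFs in question is either a restriction of a short
-- clause, whose variables T already covers, or has no variables at all.
-- In (1), S* only assigns variables left unassigned by S₀, so a long clause
-- C with C|_{S₀} open under S* is open under S₀ ∪ S*; its restriction thus
-- reappears in φ_{DT*} and is removed by the difference. In (2), ST = π_T
-- makes every variable of an open long clause determining, hence assigned by
-- S, so the clause restricts to the empty clause.
module Submission where

open import Defs
open import Data.Nat using (ℕ; _<_)
open import Data.Bool using (true; false; not)
open import Data.List using (List; _++_)
open import Data.List.Membership.Propositional using (_∈_; _∉_)
open import Data.List.Membership.Propositional.Properties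
  using (∈-filter⁻; ∈-filter⁺; ∈-++⁻; ∈-++⁺ˡ; ∈-++⁺ʳ)
import Data.List.Membership.DecPropositional as DecMem
open import Data.Product using (_×_; ∃-syntax; _,_; proj₁; proj₂)
open import Data.Sum using (_⊎_; inj₁; inj₂; [_,_])
open import Data.Empty using (⊥-elim)
open import Function using (_∘_)
open import Relation.Nullary using (¬_; ¬?)
open import Relation.Binary.PropositionalEquality using (refl)

open DecMem _≟L_ using (_∈?_)

∈-restrict⁻ : ∀ {S C l} → l ∈ restrict S C → l ∈ C × neg l ∉ S
∈-restrict⁻ {S} {C} = ∈-filter⁻ (λ l → ¬? (neg l ∈? S)) {xs = C}

∈-restrict⁺ : ∀ {S C l} → l ∈ C → neg l ∉ S → l ∈ restrict S C
∈-restrict⁺ {S} {C} = ∈-filter⁺ (λ l → ¬? (neg l ∈? S)) {xs = C}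

occurs-restrict : ∀ {S C x} → Occurs x (restrict S C) → Occurs x C
occurs-restrict (b , l∈) = b , proj₁ (∈-restrict⁻ l∈)

restrict-++ : ∀ S₀ S C → SameSet (restrict S (restrict S₀ C)) (restrict (S₀ ++ S) C)
restrict-++ S₀ S C l = to , from
  where
  to : l ∈ restrict S (restrict S₀ C) → l ∈ restrict (S₀ ++ S) C
  to l∈ with ∈-restrict⁻ {S} l∈
  ... | l∈C₀ , ¬l∈S with ∈-restrict⁻ {S₀} {C} l∈C₀
  ... | l∈C , ¬l∈S₀ = ∈-restrict⁺ {S₀ ++ S} {C} l∈C ([ ¬l∈S₀ , ¬l∈S ] ∘ ∈-++⁻ S₀)

  from : l ∈ restrict (S₀ ++ S) C → l ∈ restrict S (restrict S₀ C)
  from l∈ with ∈-restrict⁻ {S₀ ++ S} {C} l∈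
  ... | l∈C , ¬l∈S₀S =
    ∈-restrict⁺ {S} (∈-restrict⁺ {S₀} {C} l∈C (¬l∈S₀S ∘ ∈-++⁺ˡ)) (¬l∈S₀S ∘ ∈-++⁺ʳ S₀)

¬sat-++ : ∀ {S₀ S C} → (∀ l → l ∈ S → ¬ Occurs (var l) S₀) →
  ¬ Sat S₀ C → ¬ Sat S (restrict S₀ C) → ¬ Sat (S₀ ++ S) C
¬sat-++ {S₀} {S} {C} fresh ¬sat₀ ¬sat ((b , x) , l∈C , l∈S₀S) with ∈-++⁻ S₀ l∈S₀S
... | inj₁ l∈S₀ = ¬sat₀ (_ , l∈C , l∈S₀)
... | inj₂ l∈S = ¬sat (_ , ∈-restrict⁺ {S₀} {C} l∈C (fresh _ l∈S ∘ (not b ,_)) , l∈S)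

¬sat-assigned⇒neg∈ : ∀ {S C b b' x} → ¬ Sat S C → (b , x) ∈ C → (b' , x) ∈ S → neg (b , x) ∈ S
¬sat-assigned⇒neg∈ {b = true}  {true}  ¬sat l∈C l∈S = ⊥-elim (¬sat (_ , l∈C , l∈S))
¬sat-assigned⇒neg∈ {b = true}  {false} ¬sat l∈C l∈S = l∈S
¬sat-assigned⇒neg∈ {b = false} {true}  ¬sat l∈C l∈S = l∈S
¬sat-assigned⇒neg∈ {b = false} {false} ¬sat l∈C l∈S = ⊥-elim (¬sat (_ , l∈C , l∈S))

restrict-assigned-varFree : ∀ {S C} → ¬ Sat S C → (∀ x → Occurs x C → Occurs x S) →
  ∀ x → ¬ Occurs x (restrict S C)
restrict-assigned-varFree ¬sat assigned x (b , l∈) with ∈-restrict⁻ l∈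
... | l∈C , neg∉S with assigned x (b , l∈C)
... | _ , l'∈S = neg∉S (¬sat-assigned⇒neg∈ ¬sat l∈C l'∈S)

CoveredBy : ClauseSet → Clause → Set
CoveredBy χ D = (∃[ C ] (χ C × (∀ x → Occurs x D → Occurs x C))) ⊎ (∀ x → ¬ Occurs x D)

treeDec-covered : ∀ {T χ ψ} → TreeDecOf T χ → (∀ D → ψ D → CoveredBy χ D) → TreeDecOf T ψ
treeDec-covered {T} {χ} {ψ} (edges , connected) covered = edges′ , connected
  where
  edges′ : ∀ D → ψ D → ∀ x y → Occurs x D → Occurs y D →
    ∃[ u ] (u < nodeCount T × x ∈ bagOf T u × y ∈ bagOf T u)
  edges′ D ψD x y ox oy with covered D ψD
  ... | inj₁ (C , χC , within) = edges C χC x y (within x ox) (within y oy)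
  ... | inj₂ varFree = ⊥-elim (varFree x ox)

primalTW-covered : ∀ {χ ψ k} → PrimalTWAtMost χ k → (∀ D → ψ D → CoveredBy χ D) →
  PrimalTWAtMost ψ k
primalTW-covered (T , td , width) covered = T , treeDec-covered {T} td covered , width

module _ (Long Short : CNF) (T : Tree) where
  open Setup Long Short T

  ext-fresh : ∀ {j S₀ E} → Ext j S₀ E → ∀ l → l ∈ E → ¬ Occurs (var l) S₀
  ext-fresh (inj₁ (_ , empty)) l l∈ = ⊥-elim (empty l l∈)
  ext-fresh (inj₂ (inj₁ (_ , _ , _ , inU , _))) l l∈ = proj₂ (inU l l∈)
  ext-fresh (inj₂ (inj₂ (inj₁ (_ , _ , _ , empty)))) l l∈ = ⊥-elim (empty l l∈)
  ext-fresh (inj₂ (inj₂ (inj₂ (_ , _ , _ , S₁ , S₂ , same , (_ , inU₁ , _) , rest)))) l l∈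
    with ∈-++⁻ S₁ (proj₁ (same l) l∈) | rest
  ... | inj₁ l∈S₁ | _ = proj₂ (proj₁ (inU₁ l l∈S₁))
  ... | inj₂ l∈S₂ | inj₁ (_ , _ , _ , inU₂ , _) = proj₂ (proj₁ (inU₂ l l∈S₂))
  ... | inj₂ l∈S₂ | inj₂ (_ , empty) = ⊥-elim (empty l l∈S₂)

  open⇒determining : ∀ {S C x} → C ∈ Long → ¬ Sat S C → Occurs x C → Determining S x
  open⇒determining {C = C} C∈ ¬sat x∈C =
    C , C∈ , x∈C , λ { _ _ _ (_ , y∈S , y∈C) → ¬sat (_ , y∈C , y∈S) }

  phiDT-step-covered : ∀ {j j' S₀ S} → Ext j S₀ S →
    ∀ D → Minus (RestrictSet (PhiDT j S₀) S) (PhiDT j' (S₀ ++ S)) D → CoveredBy (_∈ Short) D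
  phiDT-step-covered {S₀ = S₀} {S} _ _ ((_ , (C , inj₂ (C∈ , _) , _ , refl) , _ , refl) , _) =
    inj₁ (C , C∈ , λ _ → occurs-restrict {S₀} {C} ∘ occurs-restrict {S})
  phiDT-step-covered {S₀ = S₀} {S} ext _
    ((_ , (C , inj₁ (C∈ , _) , ¬sat₀ , refl) , ¬sat , refl) , ∉next) =
    ⊥-elim (∉next (restrict (S₀ ++ S) C , (C , inj₁ (C∈ , ¬sat₀₊) , ¬sat₀₊ , refl) , restrict-++ S₀ S C))
    where
    ¬sat₀₊ : ¬ Sat (S₀ ++ S) C
    ¬sat₀₊ = ¬sat-++ (ext-fresh ext) ¬sat₀ ¬sat

  phiDT-final-covered : ∀ {S} → (∀ C x → C ∈ Long → Occurs x C → VarPre N x) → Interesting N S →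
    ∀ D → PhiDT N S D → CoveredBy (_∈ Short) D
  phiDT-final-covered {S} _ _ _ (C , inj₂ (C∈ , _) , _ , refl) =
    inj₁ (C , C∈ , λ _ → occurs-restrict {S} {C})
  phiDT-final-covered longsInT (_ , _ , _ , determined , _) _ (C , inj₁ (C∈ , _) , ¬sat , refl) =
    inj₂ (restrict-assigned-varFree ¬sat λ x x∈C →
      determined x (longsInT C x C∈ x∈C) (open⇒determining C∈ ¬sat x∈C))

lemma7 : (k : ℕ) (Long Short : CNF) (T : Tree) →
    Unsat (Long ++ Short) →
    (∀ C → C ∈ Short → C ∉ Long) →
    TreeDecOf T (λ C → C ∈ Short) →
    WidthAtMost T k →
    Binary T →
    (∀ C x → C ∈ Long → Occurs x C → ∃[ u ] (u < nodeCount T × x ∈ bagOf T u)) →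
    ((j : ℕ) (S₀ : List Lit) → j < nodeCount T →
      Setup.Interesting Long Short T j S₀ → Setup.Firm Long Short T j S₀ →
      (S* : List Lit) → Setup.Ext Long Short T j S₀ S* →
      (j' : ℕ) → Setup.SuccStar Long Short T j S₀ S* j' →
      PrimalTWAtMost
        (Minus (RestrictSet (Setup.PhiDT Long Short T j S₀) S*)
               (Setup.PhiDT Long Short T j' (S₀ ++ S*)))
        k)
    ×
    ((S : List Lit) → Setup.Interesting Long Short T (nodeCount T) S →
      PrimalTWAtMost (Setup.PhiDT Long Short T (nodeCount T) S) k)
lemma7 k Long Short T _ _ td width _ longsInT =
  (λ _ _ _ _ _ _ ext _ _ → primalTW-covered twShort (phiDT-step-covered Long Short T ext)) ,
  (λ _ interesting → primalTW-covered twShort (phiDT-final-covered Long Short T longsInT interesting))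
  where
  twShort : PrimalTWAtMost (_∈ Short) k
  twShort = T , td , width
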